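{- Let $D = (V, E)$ be a simple $1$-regular digraph and $x, y, z \in \{0,1,+,-\}$. For $w \in V \cup E$ let $\varepsilon (w) = t^{ -1}(w)$ (the unique arc with tail $w$) if $w \in V$, and $\varepsilon (w) = h(w)$ if $w \in E$. Then $\varepsilon$ is an isomorphism from $D^{xyz}$ to $D^{yxz}$.
   Context: A simple digraph is $D=(V,E)$ with $V$ finite nonempty and $E\subseteq\{(u,v)\in V\times V:u\neq v\}$; for $e=(u,v)$, $t(e)=u$, $h(e)=v$. $D$ is $1$-regular if every vertex has in-degree and out-degree $1$. The line digraph $D^l$ has vertex set $E$ and arcs $(p,q)$ for $p,q\in E$ with $h(p)=t(q)$. For a simple digraph $G$ on vertex set $U$: $G^0$ has no arcs, $G^1$ has all arcs $(u,v)$ with $u\neq v$, $G^+=G$, $G^-$ is the complement (all $(u,v)$, $u\neq v$, not arcs of $G$). For $x,y,z\in\{0,1,+,-\}$, $D^{xyz}$ is the digraph on vertex set $V\cup E$ (disjoint union) whose arcs are those of $D^x$ (on $V$), those of $(D^l)^y$ (on $E$), and a set $W$ of arcs between $V$ and $E$: $W=\emptyset$ if $z=0$; $W=\{(v,e):v=t(e)\}\cup\{(e,v):v=h(e)\}$ if $z=+$; $W=\{(v,e):v\neq t(e)\}\cup\{(e,v):v\neq h(e)\}$ if $z=-$; $W$ = all $(v,e)$ and $(e,v)$ if $z=1$ (always $v\in V$, $e\in E$). An isomorphism is a vertex bijection mapping arcs exactly onto arcs. -}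

module Defs where

open import Data.Nat using (ℕ; _+_; NonZero)
open import Data.Fin using (Fin; _≟_)
open import Data.Bool using (Bool; true; false; not; _∧_; T; if_then_else_)
open import Data.List using (List; map; allFin)
open import Data.Nat.ListAction using (sum)
open import Data.Product using (Σ; _×_; _,_; proj₁; proj₂)
open import Data.Sum using (_⊎_; inj₁; inj₂)
open import Relation.Nullary.Decidable using (⌊_⌋)
open import Relation.Binary.PropositionalEquality using (_≡_)
open import Function.Definitions using (Bijective)

record SimpleDigraph : Set where
  field
    n        : ℕ
    nonempty : NonZero n
    adj      : Fin n → Fin n → Bool
    loopless : ∀ v → adj v v ≡ false

module _ (D : SimpleDigraph) where
  open SimpleDigraph D

  V : Set
  V = Fin n

  E : Set
  E = Σ (V × V) (λ uv → T (adj (proj₁ uv) (proj₂ uv)))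

  tl : E → V
  tl ((u , _) , _) = u

  hd : E → V
  hd ((_ , v) , _) = v

  outdeg : V → ℕ
  outdeg u = sum (map (λ v → if adj u v then 1 else 0) (allFin n))

  indeg : V → ℕ
  indeg v = sum (map (λ u → if adj u v then 1 else 0) (allFin n))

  OneRegular : Set
  OneRegular = ∀ v → indeg v ≡ 1 × outdeg v ≡ 1

  eqV : V → V → Bool
  eqV u v = ⌊ u ≟ v ⌋

  eqE : E → E → Bool
  eqE p q = eqV (tl p) (tl q) ∧ eqV (hd p) (hd q)

  lineAdj : E → E → Bool
  lineAdj p q = eqV (hd p) (tl q)

data Op : Set where
  op0 op1 op+ op- : Op

applyOp : {A : Set} → Op → (A → A → Bool) → (A → A → Bool) → A → A → Bool
applyOp op0 eq g a b = false
applyOp op1 eq g a b = not (eq a b)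
applyOp op+ eq g a b = g a b
applyOp op- eq g a b = not (eq a b) ∧ not (g a b)

-- membership in W, given whether the incidence condition (v = t(e) resp. v = h(e)) holds
cross : Op → Bool → Bool
cross op0 b = false
cross op1 b = true
cross op+ b = b
cross op- b = not b

module _ (D : SimpleDigraph) where
  open SimpleDigraph D

  VE : Set
  VE = V D ⊎ E D

  Dxyz : Op → Op → Op → VE → VE → Bool
  Dxyz x y z (inj₁ u) (inj₁ v) = applyOp x (eqV D) adj u v
  Dxyz x y z (inj₂ p) (inj₂ q) = applyOp y (eqE D) (lineAdj D) p q
  Dxyz x y z (inj₁ v) (inj₂ e) = cross z (eqV D v (tl D e))
  Dxyz x y z (inj₂ e) (inj₁ v) = cross z (eqV D v (hd D e))

IsIsomorphism : {A B : Set} → (A → A → Bool) → (B → B → Bool) → (A → B) → Set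
IsIsomorphism {A} {B} G H f =
  Bijective _≡_ _≡_ f × (∀ a b → G a b ≡ H (f a) (f b))

module Submission where

-- Let D be a simple 1-regular digraph, σ : V → E the map sending a vertex to
-- its unique out-arc and hd : E → V the head map.  Both σ and hd are bijections (σ is inverse to the tail
-- map; hd is injective and surjective because every in-degree is 1), and they
-- exchange the structures on V and on E:
--   u = v   ⇔ σ u = σ v,      (u,v) ∈ D   ⇔ h(σ u) = t(σ v),
--   p = q   ⇔ h p = h q,      h p = t q   ⇔ (h p, h q) ∈ D.
-- Each adjacency of D^{xyz} is a Boolean built from such tests, so it suffices
-- to compare the propositions the Booleans reflect.

open import Defs
open import Data.Bool using (Bool; true; false; not; _∧_; T; if_then_else_)
open import Data.Bool.Properties using (T-irrelevant)
open import Data.Empty using (⊥-elim)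
open import Data.Fin using (Fin; zero; suc; _≟_)
open import Data.List using (map; allFin; tabulate)
open import Data.List.Properties using (map-tabulate)
open import Data.Nat using (ℕ; _+_)
open import Data.Nat.ListAction using (sum)
open import Data.Nat.Properties using (suc-injective)
open import Data.Product using (Σ; ∃!; _×_; _,_; proj₁; proj₂)
open import Data.Sum using (inj₁; inj₂)
open import Data.Sum.Properties using (inj₁-injective; inj₂-injective)
open import Data.Unit using (tt)
open import Function using (_∘_)
open import Function.Bundles using (_⇔_; mk⇔; Equivalence)
open import Function.Construct.Symmetry using (⇔-sym)
open import Function.Definitions using (Injective; Surjective)
open import Function.Related.Propositional using (module EquationalReasoning; equivalence)
open import Relation.Nullary using (¬_; Dec)
open import Relation.Nullary.Decidable using (isYes≗does)
open import Relation.Nullary.Reflects using (Reflects; ofʸ; ofⁿ; det; T-reflects; _×-reflects_)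
open import Relation.Binary.PropositionalEquality using (_≡_; refl; sym; trans; cong; cong₂; subst)

open EquationalReasoning {k = equivalence}

reflects-⇔ : ∀ {A B : Set} {b : Bool} → A ⇔ B → Reflects A b → Reflects B b
reflects-⇔ A⇔B (ofʸ a)  = ofʸ (Equivalence.to A⇔B a)
reflects-⇔ A⇔B (ofⁿ ¬a) = ofⁿ (¬a ∘ Equivalence.from A⇔B)

reflects-equal : ∀ {A B : Set} {a b : Bool}
  → Reflects A a → Reflects B b → A ⇔ B → a ≡ b
reflects-equal ra rb A⇔B = det (reflects-⇔ A⇔B ra) rb

applyOp-cong : ∀ {A B : Set} (o : Op) {eq g : A → A → Bool} {eq′ g′ : B → B → Bool}
  {a b : A} {a′ b′ : B}
  → eq a b ≡ eq′ a′ b′ → g a b ≡ g′ a′ b′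
  → applyOp o eq g a b ≡ applyOp o eq′ g′ a′ b′
applyOp-cong op0 same-eq same-g = refl
applyOp-cong op1 same-eq same-g = cong not same-eq
applyOp-cong op+ same-eq same-g = same-g
applyOp-cong op- same-eq same-g = cong₂ _∧_ (cong not same-eq) (cong not same-g)

count : ∀ {n} → (Fin n → Bool) → ℕ
count {ℕ.zero} f = 0
count {ℕ.suc n} f = (if f zero then 1 else 0) + count (f ∘ suc)

sum-indicator≡count : ∀ n (f : Fin n → Bool)
  → sum (map (λ i → if f i then 1 else 0) (allFin n)) ≡ count f
sum-indicator≡count n f =
  trans (cong sum (map-tabulate {n = n} (λ i → i) (λ i → if f i then 1 else 0))) (sum-tabulate n f)
  where
  sum-tabulate : ∀ n (f : Fin n → Bool)
    → sum (tabulate (λ i → if f i then 1 else 0)) ≡ count f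
  sum-tabulate ℕ.zero f = refl
  sum-tabulate (ℕ.suc n) f = cong ((if f zero then 1 else 0) +_) (sum-tabulate n (f ∘ suc))

count-zero : ∀ {n} (f : Fin n → Bool) → count f ≡ 0 → ∀ i → ¬ T (f i)
count-zero {ℕ.suc n} f c≡0 i fi with f zero in f0
count-zero {ℕ.suc n} f c≡0 zero    fi | false = subst T f0 fi
count-zero {ℕ.suc n} f c≡0 (suc i) fi | false = count-zero (f ∘ suc) c≡0 i fi
count-zero {ℕ.suc n} f ()  i       fi | true

count-one : ∀ {n} (f : Fin n → Bool) → count f ≡ 1 → ∃! _≡_ (T ∘ f)
count-one {ℕ.suc n} f c≡1 with f zero in f0
... | true = zero , subst T (sym f0) tt , only-zero
  where
  only-zero : ∀ {i} → T (f i) → zero ≡ i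
  only-zero {zero}  _  = refl
  only-zero {suc i} fi = ⊥-elim (count-zero (f ∘ suc) (suc-injective c≡1) i fi)
... | false with count-one (f ∘ suc) c≡1
... | i , fi , unique = suc i , fi , only-suc-i
  where
  only-suc-i : ∀ {j} → T (f j) → suc i ≡ j
  only-suc-i {zero}  fj = ⊥-elim (subst T f0 fj)
  only-suc-i {suc j} fj = cong suc (unique fj)

∃!-unique : ∀ {A : Set} {P : A → Set} → ∃! _≡_ P → ∀ {a b} → P a → P b → a ≡ b
∃!-unique (_ , _ , unique) pa pb = trans (sym (unique pa)) (unique pb)

module Arcs (D : SimpleDigraph) where
  open SimpleDigraph D

  eqV-reflects : ∀ u v → Reflects (u ≡ v) (eqV D u v)
  eqV-reflects u v = subst (Reflects (u ≡ v)) (sym (isYes≗does (u ≟ v))) (Dec.proof (u ≟ v))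

  -- An arc is determined by its endpoints (membership in E is a proposition).
  arc-ext : ∀ {p q : E D} → tl D p ≡ tl D q → hd D p ≡ hd D q → p ≡ q
  arc-ext {(u , v) , a} {(.u , .v) , a′} refl refl = cong ((u , v) ,_) (T-irrelevant a a′)

  eqE-reflects : ∀ p q → Reflects (p ≡ q) (eqE D p q)
  eqE-reflects p q = reflects-⇔ endpoints⇔arc
    (eqV-reflects (tl D p) (tl D q) ×-reflects eqV-reflects (hd D p) (hd D q))
    where
    endpoints⇔arc : (tl D p ≡ tl D q × hd D p ≡ hd D q) ⇔ (p ≡ q)
    endpoints⇔arc = mk⇔ (λ (t , h) → arc-ext t h) (λ { refl → refl , refl })

  is-arc : (e : E D) → T (adj (tl D e) (hd D e))
  is-arc (_ , a) = a

module OneRegularArcs (D : SimpleDigraph) (reg : OneRegular D) where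
  open SimpleDigraph D
  open Arcs D

  out-neighbour : ∀ u → ∃! _≡_ (λ v → T (adj u v))
  out-neighbour u = count-one (adj u)
    (trans (sym (sum-indicator≡count n (adj u))) (proj₂ (reg u)))

  in-neighbour : ∀ v → ∃! _≡_ (λ u → T (adj u v))
  in-neighbour v = count-one (λ u → adj u v)
    (trans (sym (sum-indicator≡count n (λ u → adj u v))) (proj₁ (reg v)))

  -- Out-degree 1: an arc is determined by its tail.
  tail-injective : ∀ {p q : E D} → tl D p ≡ tl D q → p ≡ q
  tail-injective {p} {q} refl =
    arc-ext refl (∃!-unique (out-neighbour (tl D p)) (is-arc p) (is-arc q))

  -- In-degree 1: an arc is determined by its head.
  head-injective : ∀ {p q : E D} → hd D p ≡ hd D q → p ≡ q
  head-injective {p} {q} refl =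
    arc-ext (∃!-unique (in-neighbour (hd D p)) (is-arc p) (is-arc q)) refl

  head-equal⇔ : ∀ {p q : E D} → (p ≡ q) ⇔ (hd D p ≡ hd D q)
  head-equal⇔ = mk⇔ (cong (hd D)) head-injective

  -- In-degree 1: every vertex is the head of some arc.
  arc-into : ∀ v → Σ (E D) (λ e → hd D e ≡ v)
  arc-into v with in-neighbour v
  ... | u , a , _ = ((u , v) , a) , refl

module OutArcSelector (D : SimpleDigraph) (reg : OneRegular D)
  (σ : V D → E D) (σ-tail : ∀ v → tl D (σ v) ≡ v) where
  open SimpleDigraph D
  open Arcs D
  open OneRegularArcs D reg

  σ-inverse : ∀ {u e} → (σ u ≡ e) ⇔ (u ≡ tl D e)
  σ-inverse {u} = mk⇔ (λ { refl → sym (σ-tail u) })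
                      (λ { refl → tail-injective (σ-tail u) })

  σ-equal⇔ : ∀ {u v} → (u ≡ v) ⇔ (σ u ≡ σ v)
  σ-equal⇔ {u} {v} = mk⇔ (cong σ)
    (λ same → trans (sym (σ-tail u)) (trans (cong (tl D) same) (σ-tail v)))

  adjacent⇔ : ∀ {u v} → T (adj u v) ⇔ (hd D (σ u) ≡ v)
  adjacent⇔ {u} {v} = mk⇔
    (λ a → cong (hd D) (Equivalence.from (σ-inverse {e = (u , v) , a}) refl))
    (λ { refl → subst (λ w → T (adj w (hd D (σ u)))) (σ-tail u) (is-arc (σ u)) })

  eqV≡eqE-σ : ∀ u v → eqV D u v ≡ eqE D (σ u) (σ v)
  eqV≡eqE-σ u v = reflects-equal (eqV-reflects u v) (eqE-reflects (σ u) (σ v)) σ-equal⇔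

  adj≡lineAdj-σ : ∀ u v → adj u v ≡ lineAdj D (σ u) (σ v)
  adj≡lineAdj-σ u v = reflects-equal (T-reflects (adj u v))
    (eqV-reflects (hd D (σ u)) (tl D (σ v)))
    (subst (λ w → T (adj u v) ⇔ (hd D (σ u) ≡ w)) (sym (σ-tail v)) adjacent⇔)

  eqE≡eqV-hd : ∀ p q → eqE D p q ≡ eqV D (hd D p) (hd D q)
  eqE≡eqV-hd p q = reflects-equal (eqE-reflects p q) (eqV-reflects (hd D p) (hd D q)) head-equal⇔

  lineAdj≡adj-hd : ∀ p q → lineAdj D p q ≡ adj (hd D p) (hd D q)
  lineAdj≡adj-hd p q = reflects-equal (eqV-reflects (hd D p) (tl D q))
    (T-reflects (adj (hd D p) (hd D q))) (begin
      hd D p ≡ tl D q               ∼⟨ ⇔-sym σ-inverse ⟩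
      σ (hd D p) ≡ q                ∼⟨ head-equal⇔ ⟩
      hd D (σ (hd D p)) ≡ hd D q    ∼⟨ ⇔-sym adjacent⇔ ⟩
      T (adj (hd D p) (hd D q))     ∎)

  tail-incidence : ∀ v e → eqV D v (tl D e) ≡ eqV D (hd D e) (hd D (σ v))
  tail-incidence v e = reflects-equal (eqV-reflects v (tl D e))
    (eqV-reflects (hd D e) (hd D (σ v))) (begin
      v ≡ tl D e               ∼⟨ ⇔-sym σ-inverse ⟩
      σ v ≡ e                  ∼⟨ head-equal⇔ ⟩
      hd D (σ v) ≡ hd D e      ∼⟨ mk⇔ sym sym ⟩
      hd D e ≡ hd D (σ v)      ∎)

  head-incidence : ∀ v e → eqV D v (hd D e) ≡ eqV D (hd D e) (tl D (σ v))
  head-incidence v e = reflects-equal (eqV-reflects v (hd D e))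
    (eqV-reflects (hd D e) (tl D (σ v)))
    (mk⇔ (λ { refl → sym (σ-tail v) }) (λ h → sym (trans h (σ-tail v))))

  exchange : VE D → VE D
  exchange (inj₁ v) = inj₂ (σ v)
  exchange (inj₂ e) = inj₁ (hd D e)

  exchange-preserves : ∀ x y z a b → Dxyz D x y z a b ≡ Dxyz D y x z (exchange a) (exchange b)
  exchange-preserves x y z (inj₁ u) (inj₁ v) = applyOp-cong x (eqV≡eqE-σ u v) (adj≡lineAdj-σ u v)
  exchange-preserves x y z (inj₂ p) (inj₂ q) = applyOp-cong y (eqE≡eqV-hd p q) (lineAdj≡adj-hd p q)
  exchange-preserves x y z (inj₁ v) (inj₂ e) = cong (cross z) (tail-incidence v e)
  exchange-preserves x y z (inj₂ e) (inj₁ v) = cong (cross z) (head-incidence v e)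

  exchange-injective : Injective _≡_ _≡_ exchange
  exchange-injective {inj₁ u} {inj₁ v} same = cong inj₁ (Equivalence.from σ-equal⇔ (inj₂-injective same))
  exchange-injective {inj₂ p} {inj₂ q} same = cong inj₂ (head-injective (inj₁-injective same))
  exchange-injective {inj₁ _} {inj₂ _} ()
  exchange-injective {inj₂ _} {inj₁ _} ()

  exchange-surjective : Surjective _≡_ _≡_ exchange
  exchange-surjective (inj₁ v) = inj₂ (proj₁ (arc-into v)) , λ { refl → cong inj₁ (proj₂ (arc-into v)) }
  exchange-surjective (inj₂ e) = inj₁ (tl D e) , λ { refl → cong inj₂ (Equivalence.from σ-inverse refl) }

  exchange-isomorphism : ∀ x y z → IsIsomorphism (Dxyz D x y z) (Dxyz D y x z) exchange
  exchange-isomorphism x y z = (exchange-injective , exchange-surjective) , exchange-preserves x y z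

-- Being an isomorphism only depends on the values of the map; this lets the
-- theorem pass from the concrete exchange map to any ε agreeing with it.
isomorphism-pointwise : ∀ {A B : Set} {G : A → A → Bool} {H : B → B → Bool} {f g : A → B}
  → IsIsomorphism G H f → (∀ a → g a ≡ f a) → IsIsomorphism G H g
isomorphism-pointwise {G = G} {H} {g = g} ((f-inj , f-surj) , f-hom) g≗f =
  (g-inj , g-surj) , g-hom
  where
  g-inj : Injective _≡_ _≡_ g
  g-inj {a} {b} e = f-inj (trans (sym (g≗f a)) (trans e (g≗f b)))
  g-surj : Surjective _≡_ _≡_ g
  g-surj y = proj₁ (f-surj y) , λ {c} c≡x → trans (g≗f c) (proj₂ (f-surj y) c≡x)
  g-hom : ∀ a b → G a b ≡ H (g a) (g b)
  g-hom a b = trans (f-hom a b) (cong₂ H (sym (g≗f a)) (sym (g≗f b)))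

-- Theorem 6.8: ε agrees with the exchange map for the out-arc selector it
-- induces, hence is an isomorphism D^{xyz} → D^{yxz}.
theorem6p8 : (D : SimpleDigraph) → OneRegular D → (x y z : Op)
    → (ε : VE D → VE D)
    → (∀ v → Σ (E D) (λ e → tl D e ≡ v × ε (inj₁ v) ≡ inj₂ e))
    → (∀ e → ε (inj₂ e) ≡ inj₁ (hd D e))
    → IsIsomorphism (Dxyz D x y z) (Dxyz D y x z) ε
theorem6p8 D reg x y z ε ε-vertex ε-arc =
  isomorphism-pointwise {H = Dxyz D y x z} (exchange-isomorphism x y z) ε≗exchange
  where
  σ : V D → E D
  σ v = proj₁ (ε-vertex v)

  open OutArcSelector D reg σ (λ v → proj₁ (proj₂ (ε-vertex v)))

  ε≗exchange : ∀ a → ε a ≡ exchange a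
  ε≗exchange (inj₁ v) = proj₂ (proj₂ (ε-vertex v))
  ε≗exchange (inj₂ e) = ε-arc e
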